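{- Let $G$ be a 1-planar graph drawn in the plane so that each edge is crossed by at most one other edge, and let $G^\times$ be its associated plane graph. If a true vertex $v$ of $G^\times$ is incident with three consecutive false 3-faces of $G^\times$ (i.e., faces $f_1,f_2,f_3$ incident with $v$ such that $f_1,f_2$ share an edge incident with $v$ and $f_2,f_3$ share an edge incident with $v$), then the induced subgraph $G[N(v)]$ contains an edge of $G$, where $N(v)$ is the neighborhood of $v$ in $G$.
   Context: All graphs are finite, simple and undirected. A graph is 1-planar if it can be drawn in the plane so that each edge is crossed by at most one other edge. The associated plane graph $G^\times$ of a drawn 1-planar graph $G$ is the plane graph obtained from $G$ by replacing every crossing point of two edges by a new vertex of degree four; these new vertices are called false vertices and the vertices of $G$ are called true vertices. A $t$-face of a plane graph is a face whose boundary closed walk has length $t$. A face of $G^\times$ is false if it is incident with at least one false vertex, and true otherwise. -}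

module Defs where

open import Data.Nat using (ℕ; zero; suc; _+_; _*_)
open import Data.Fin using (Fin)
open import Data.Sum using (_⊎_; inj₁; inj₂)
open import Data.Product using (Σ; ∃; _×_; _,_)
open import Relation.Binary.PropositionalEquality using (_≡_)
open import Relation.Nullary using (¬_)
open import Function.Bundles using (_⇔_)
open import Relation.Binary.Construct.Closure.ReflexiveTransitive using (Star)

iter : {A : Set} → (A → A) → ℕ → A → A
iter f zero    x = x
iter f (suc k) x = f (iter f k x)

SameOrbit : {A : Set} → (A → A) → A → A → Set
SameOrbit f d e = ∃ λ k → iter f k d ≡ e

-- The equivalence relation R on Fin m has exactly K classes:
-- a surjective labelling whose fibres are exactly the R-classes.
HasClassCount : (m : ℕ) → (Fin m → Fin m → Set) → ℕ → Set
HasClassCount m R K =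
  Σ (Fin m → Fin K) λ lab →
    (∀ c → ∃ λ d → lab d ≡ c) × (∀ d e → (lab d ≡ lab e) ⇔ R d e)

record SimpleGraph (n : ℕ) : Set₁ where
  field
    Adj     : Fin n → Fin n → Set
    sym     : ∀ {u w} → Adj u w → Adj w u
    irrefl  : ∀ {u} → ¬ Adj u u

-- Combinatorial maps (rotation systems) on a finite set of darts Fin m.
-- α : the other half of the same edge, σ : next dart around the tail
-- vertex (rotation), φ = σ ∘ α : face traversal.  The face "between"
-- consecutive darts e and σ e at a vertex is the φ-orbit of σ e
-- (it contains α e and σ e, since φ (α e) = σ e).

record CombMap (m : ℕ) : Set where
  field
    α       : Fin m → Fin m
    σ       : Fin m → Fin m
    σ⁻¹     : Fin m → Fin m
    α-invol : ∀ d → α (α d) ≡ d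
    α-fpf   : ∀ d → ¬ α d ≡ d
    σ-inv₁  : ∀ d → σ (σ⁻¹ d) ≡ d
    σ-inv₂  : ∀ d → σ⁻¹ (σ d) ≡ d

  φ : Fin m → Fin m
  φ d = σ (α d)

  Step : Fin m → Fin m → Set
  Step d e = (e ≡ α d) ⊎ (e ≡ σ d)

  Connected : Fin m → Fin m → Set
  Connected = Star Step

  -- Genus zero (every component is a sphere): Euler's formula
  -- V - E + F = 2C with E = m/2, i.e. 2V + 2F = m + 4C.
  Plane : Set
  Plane = ∃ λ V → ∃ λ F → ∃ λ C →
            HasClassCount m (SameOrbit σ) V ×
            HasClassCount m (SameOrbit φ) F ×
            HasClassCount m Connected C ×
            (2 * (V + F) ≡ m + 4 * C)

-- A 1-planar drawing of G (on true vertices Fin n), given through its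
-- associated plane graph G× : a plane combinatorial map whose vertices
-- are true vertices (inj₁ u, u : Fin n) or false vertices (inj₂ x,
-- crossing points x : Fin k).

record OnePlaneDrawing {n : ℕ} (G : SimpleGraph n) : Set₁ where
  open SimpleGraph G
  field
    m     : ℕ
    k     : ℕ
    map   : CombMap m
  open CombMap map public
  field
    plane     : Plane
    -- vertex (tail) of each dart; vertices of G× are exactly σ-orbits
    vert      : Fin m → Fin n ⊎ Fin k
    vert-orb  : ∀ d e → (vert d ≡ vert e) ⇔ SameOrbit σ d e
    false-occ : ∀ x → ∃ λ d → vert d ≡ inj₂ x
    false-deg : ∀ d x → vert d ≡ inj₂ x →
                  (iter σ 4 d ≡ d) × ¬ (iter σ 2 d ≡ d)
    -- each edge is crossed at most once: no two crossings are joined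
    -- by an edge segment of G×
    once      : ∀ d x → vert d ≡ inj₂ x → ∃ λ u → vert (α d) ≡ inj₁ u
    -- the edges of G are exactly the uncrossed edges of G× between true
    -- vertices and the curves u – x – w passing straight (to the
    -- opposite dart) through a crossing point x
    edges     : ∀ u w → Adj u w ⇔
                  ((∃ λ d → (vert d ≡ inj₁ u) × (vert (α d) ≡ inj₁ w)) ⊎
                   (∃ λ d → ∃ λ x → (vert d ≡ inj₁ u) × (vert (α d) ≡ inj₂ x) ×
                              (vert (α (iter σ 2 (α d))) ≡ inj₁ w)))

  ThreeFace : Fin m → Set
  ThreeFace e = (iter φ 3 e ≡ e) × ¬ (φ e ≡ e)

  FalseFace : Fin m → Set
  FalseFace e = ∃ λ j → ∃ λ x → vert (iter φ j e) ≡ inj₂ x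

  FalseThreeFace : Fin m → Set
  FalseThreeFace e = ThreeFace e × FalseFace e

-- The darts d, σ d, σ² d, σ³ d leave v towards h₀, h₁, h₂, h₃, and the 3-face between
-- consecutive darts σⁱ d and σⁱ⁺¹ d is the triangle v hᵢ hᵢ₊₁.  The middle face is false,
-- so h₁ or h₂ is a crossing, say hⱼ; its two triangles make both neighbours hⱼ₋₁, hⱼ₊₁ true
-- (edges are crossed at most once, so no two crossings are adjacent in G×).  Then v hⱼ₋₁
-- and v hⱼ₊₁ are uncrossed edges of G, and since the crossing hⱼ has degree four, the
-- segments hⱼ₋₁ hⱼ and hⱼ hⱼ₊₁ leave it in opposite directions: they form one edge of G.
module Submission where

open import Defs
open import Data.Nat using (zero; suc; _+_)
open import Data.Nat.Properties using (+-comm)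
open import Data.Fin using (Fin)
open import Data.Sum using (_⊎_; inj₁; inj₂)
open import Data.Product using (∃; _×_; _,_; proj₁)
open import Function.Bundles using (Equivalence)
open import Relation.Binary.PropositionalEquality
open ≡-Reasoning

module _ {A : Set} (f : A → A) where

  iter-+ : ∀ j k x → iter f (j + k) x ≡ iter f j (iter f k x)
  iter-+ zero    k x = refl
  iter-+ (suc j) k x = cong f (iter-+ j k x)

  iter-periodic : ∀ {p x} → iter f p x ≡ x → ∀ j → iter f (p + j) x ≡ iter f j x
  iter-periodic {p} {x} fᵖx≡x j = begin
    iter f (p + j) x       ≡⟨ cong (λ i → iter f i x) (+-comm p j) ⟩
    iter f (j + p) x       ≡⟨ iter-+ j p x ⟩
    iter f j (iter f p x)  ≡⟨ cong (iter f j) fᵖx≡x ⟩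
    iter f j x             ∎

  iter-orbit₃ : ∀ {x} → iter f 3 x ≡ x → ∀ j →
                iter f j x ≡ x ⊎ iter f j x ≡ f x ⊎ iter f j x ≡ f (f x)
  iter-orbit₃ f³x≡x zero                = inj₁ refl
  iter-orbit₃ f³x≡x (suc zero)          = inj₂ (inj₁ refl)
  iter-orbit₃ f³x≡x (suc (suc zero))    = inj₂ (inj₂ refl)
  iter-orbit₃ {x} f³x≡x (suc (suc (suc j))) =
    subst (λ y → y ≡ x ⊎ y ≡ f x ⊎ y ≡ f (f x))
          (sym (iter-periodic {p = 3} f³x≡x j)) (iter-orbit₃ f³x≡x j)

module _ {n} {G : SimpleGraph n} (D : OnePlaneDrawing G) where
  open OnePlaneDrawing D
  open SimpleGraph G using (Adj)

  head : Fin m → Fin n ⊎ Fin k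
  head e = vert (α e)

  vert-σ : ∀ e → vert (σ e) ≡ vert e
  vert-σ e = sym (Equivalence.from (vert-orb e (σ e)) (1 , refl))

  vert-φ : ∀ e → vert (φ e) ≡ head e
  vert-φ e = vert-σ (α e)

  head-α : ∀ e → head (α e) ≡ vert e
  head-α e = cong vert (α-invol e)

  φ⁻¹ : Fin m → Fin m
  φ⁻¹ e = α (σ⁻¹ e)

  φ⁻¹-φ : ∀ e → φ⁻¹ (φ e) ≡ e
  φ⁻¹-φ e = trans (cong α (σ-inv₂ (α e))) (α-invol e)

  -- The face of σ e always contains α e, since φ (α e) = σ e.
  threeFace-last : ∀ e → ThreeFace (σ e) → φ (φ (σ e)) ≡ α e
  threeFace-last e (φ³≡id , _) = begin
    φ (φ (σ e))               ≡⟨ sym (φ⁻¹-φ _) ⟩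
    φ⁻¹ (φ (φ (φ (σ e))))     ≡⟨ cong φ⁻¹ φ³≡id ⟩
    φ⁻¹ (σ e)                 ≡⟨ cong α (σ-inv₂ e) ⟩
    α e                       ∎

  threeFace-side : ∀ e → ThreeFace (σ e) → head (φ (σ e)) ≡ head e
  threeFace-side e t = trans (sym (vert-σ _)) (cong vert (threeFace-last e t))

  head-true-before-crossing : ∀ {e x} → ThreeFace (σ e) → head (σ e) ≡ inj₂ x →
                              ∃ λ a → head e ≡ inj₁ a
  head-true-before-crossing {e} {x} t crossing
    with a , ha ← once (φ (σ e)) x (trans (vert-φ _) crossing)
    = a , trans (sym (threeFace-side e t)) ha

  head-true-after-crossing : ∀ {e x} → ThreeFace (σ e) → head e ≡ inj₂ x →
                             ∃ λ b → head (σ e) ≡ inj₁ b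
  head-true-after-crossing {e} {x} t crossing
    with b , hb ← once (α (φ (σ e))) x (trans (threeFace-side e t) crossing)
    = b , trans (sym (trans (head-α _) (vert-φ _))) hb

  falseThreeFace-crossing : ∀ {e v} → vert e ≡ inj₁ v → FalseThreeFace (σ e) →
                            (∃ λ x → head e ≡ inj₂ x) ⊎ (∃ λ x → head (σ e) ≡ inj₂ x)
  falseThreeFace-crossing {e} ve (t , j , x , falseⱼ) with iter-orbit₃ φ (proj₁ t) j
  ... | inj₁ at-σe
    with () ← trans (sym ve) (trans (sym (vert-σ e)) (trans (cong vert (sym at-σe)) falseⱼ))
  ... | inj₂ (inj₁ at-φσe) = inj₂ (x , trans (sym (vert-φ _)) (trans (cong vert (sym at-φσe)) falseⱼ))
  ... | inj₂ (inj₂ at-φφσe) =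
    inj₁ (x , trans (cong vert (sym (threeFace-last e t))) (trans (cong vert (sym at-φφσe)) falseⱼ))

  uncrossed-edge : ∀ {e u w} → vert e ≡ inj₁ u → head e ≡ inj₁ w → Adj u w
  uncrossed-edge {e} {u} {w} ve he = Equivalence.from (edges u w) (inj₁ (e , ve , he))

  edge-through-crossing : ∀ {e a x b} → ThreeFace (σ e) → ThreeFace (σ (σ e)) →
                          head e ≡ inj₁ a → head (σ e) ≡ inj₂ x → head (σ (σ e)) ≡ inj₁ b →
                          Adj a b
  edge-through-crossing {e} {a} {x} {b} t₁ t₂ ha hx hb =
    Equivalence.from (edges a b) (inj₂ (α c₁ , x , ha′ , hx′ , hb′))
    where
    c₁ c₂ : Fin m
    c₁ = φ (σ e)
    c₂ = φ (σ (σ e))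

    c₂-at-crossing : vert (α c₂) ≡ inj₂ x
    c₂-at-crossing = trans (threeFace-side (σ e) t₂) hx

    -- c₁ and α c₂ are opposite darts at the degree-four crossing.
    straight-through : iter σ 2 c₁ ≡ α c₂
    straight-through = begin
      σ (σ c₁)                  ≡⟨ cong (λ y → σ (σ (σ y))) (sym (threeFace-last (σ e) t₂)) ⟩
      iter σ 4 (α c₂)           ≡⟨ proj₁ (false-deg (α c₂) x c₂-at-crossing) ⟩
      α c₂                      ∎

    ha′ : vert (α c₁) ≡ inj₁ a
    ha′ = trans (threeFace-side e t₁) ha

    hx′ : vert (α (α c₁)) ≡ inj₂ x
    hx′ = trans (head-α c₁) (trans (vert-φ (σ e)) hx)

    hb′ : vert (α (iter σ 2 (α (α c₁)))) ≡ inj₁ b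
    hb′ = begin
      head (iter σ 2 (α (α c₁)))  ≡⟨ cong (λ y → head (iter σ 2 y)) (α-invol c₁) ⟩
      head (iter σ 2 c₁)          ≡⟨ cong head straight-through ⟩
      head (α c₂)                 ≡⟨ head-α c₂ ⟩
      vert c₂                     ≡⟨ trans (vert-φ (σ (σ e))) hb ⟩
      inj₁ b                      ∎

  crossing-neighbourhood-edge : ∀ {e v x} → vert e ≡ inj₁ v →
                                ThreeFace (σ e) → ThreeFace (σ (σ e)) → head (σ e) ≡ inj₂ x →
                                ∃ λ u → ∃ λ w → Adj v u × Adj v w × Adj u w
  crossing-neighbourhood-edge {e} ve t₁ t₂ hx
    with a , ha ← head-true-before-crossing t₁ hx
       | b , hb ← head-true-after-crossing t₂ hx
    = a , b , uncrossed-edge ve ha ,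
      uncrossed-edge (trans (vert-σ (σ e)) (trans (vert-σ e) ve)) hb ,
      edge-through-crossing t₁ t₂ ha hx hb

lemma3p2 : ∀ {n} (G : SimpleGraph n) (D : OnePlaneDrawing G) (v : Fin n)
             (d : Fin (OnePlaneDrawing.m D)) →
             OnePlaneDrawing.vert D d ≡ inj₁ v →
             OnePlaneDrawing.FalseThreeFace D (iter (OnePlaneDrawing.σ D) 1 d) →
             OnePlaneDrawing.FalseThreeFace D (iter (OnePlaneDrawing.σ D) 2 d) →
             OnePlaneDrawing.FalseThreeFace D (iter (OnePlaneDrawing.σ D) 3 d) →
             ∃ λ u → ∃ λ w → SimpleGraph.Adj G v u × SimpleGraph.Adj G v w ×
               SimpleGraph.Adj G u w
lemma3p2 G D v d vd (t₁ , _) f₂@(t₂ , _) (t₃ , _)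
  with falseThreeFace-crossing D (trans (vert-σ D d) vd) f₂
... | inj₁ (_ , h₁) = crossing-neighbourhood-edge D vd t₁ t₂ h₁
... | inj₂ (_ , h₂) = crossing-neighbourhood-edge D (trans (vert-σ D d) vd) t₂ t₃ h₂
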